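{- Let $X$ be a finite non-empty set, $P\in\mathfrak{P}(X)$ connected, and $(a,b)\in\mathrm{Crit}(P)$. If $(a,b)\in L(P)\times U(P)$, then $P(a,b)$ does not have an FPP-graph. Moreover, if $P$ has an FPP-graph, the converse also holds: if $P(a,b)$ does not have an FPP-graph, then $(a,b)\in L(P)\times U(P)$.
   Context: $\mathfrak{P}(X)$ is the set of all posets with carrier $X$. For a poset $P$: $[x,y]_P=\{z: x\leq_P z\leq_P y\}$; $L(P)$, $U(P)$ are the sets of minimal and maximal elements, $M(P)=X\setminus(L(P)\cup U(P))$; $\prec_P=\{(x,y)\in<_P: M(P)\cap[x,y]_P=\emptyset\}$. $P\setminus(x,y)=(X,\leq_P\setminus\{(x,y)\})$ and $P(a,b)=(X,\leq_P\cup\{(a,b)\})$. $P$ is connected iff its comparability graph is connected. $P$ has an FPP-graph iff $P$ is connected and $P\setminus(x,y)$ is disconnected for every $(x,y)\in\prec_P$. $\mathrm{Crit}(P)$ is the set of $(a,b)\in X\times X$ with $a,b$ incomparable in $P$, $\{z: z<_P a\}\subseteq\{z: z<_P b\}$ and $\{z: b<_P z\}\subseteq\{z: a<_P z\}$; for such pairs $P(a,b)$ is a poset, and these are exactly the upper covers of $P$ in $\mathfrak{P}(X)$ ordered by inclusion of order relations. -}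

module Defs where

open import Data.Nat using (ℕ)
open import Data.Fin using (Fin; _≟_)
open import Data.Bool using (Bool; T; _∧_; _∨_; not)
open import Data.Product using (_×_)
open import Relation.Nullary using (¬_)
open import Relation.Nullary.Decidable using (⌊_⌋)
open import Relation.Binary.PropositionalEquality using (_≡_; _≢_)

-- A (candidate) order relation on the carrier Fin n, given by its
-- (decidable) characteristic function: x ≤ y  iff  T (R x y).
Rel : ℕ → Set
Rel n = Fin n → Fin n → Bool

module _ {n : ℕ} (R : Rel n) where

  _≤R_ : Fin n → Fin n → Set
  x ≤R y = T (R x y)

  _<R_ : Fin n → Fin n → Set
  x <R y = x ≤R y × x ≢ y

  record IsPoset : Set where
    field
      refl  : ∀ x → x ≤R x
      antisym : ∀ x y → x ≤R y → y ≤R x → x ≡ y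
      trans : ∀ x y z → x ≤R y → y ≤R z → x ≤R z

  Comparable : Fin n → Fin n → Set
  Comparable x y = T (R x y ∨ R y x)

  data Reach : Fin n → Fin n → Set where
    here : ∀ {x} → Reach x x
    step : ∀ {x y z} → Comparable x y → Reach y z → Reach x z

  Connected : Set
  Connected = ∀ x y → Reach x y

  -- L(P), U(P), M(P)
  Minimal : Fin n → Set
  Minimal x = ∀ z → z ≤R x → z ≡ x

  Maximal : Fin n → Set
  Maximal x = ∀ z → x ≤R z → z ≡ x

  InM : Fin n → Set
  InM x = ¬ Minimal x × ¬ Maximal x

  Prec : Fin n → Fin n → Set
  Prec x y = x <R y × (∀ z → x ≤R z → z ≤R y → ¬ InM z)

  Crit : Fin n → Fin n → Set
  Crit a b = ¬ (a ≤R b) × ¬ (b ≤R a)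
           × (∀ z → z <R a → z <R b)
           × (∀ z → b <R z → a <R z)

remove : ∀ {n} → Rel n → Fin n → Fin n → Rel n
remove R x y u v = R u v ∧ not (⌊ u ≟ x ⌋ ∧ ⌊ v ≟ y ⌋)

add : ∀ {n} → Rel n → Fin n → Fin n → Rel n
add R a b u v = R u v ∨ (⌊ u ≟ a ⌋ ∧ ⌊ v ≟ b ⌋)

HasFPP : ∀ {n} → Rel n → Set
HasFPP R = Connected R × (∀ x y → Prec R x y → ¬ Connected (remove R x y))

-- Adding the critical pair (a,b) keeps every relation of P, so P(a,b) is
-- connected and any cover pair (x,y) ≠ (a,b) of P(a,b) is one of P, since
-- M(P) ⊆ M(P(a,b)).  If a is minimal and b maximal in P, then (a,b) is a cover
-- pair of P(a,b) whose removal gives back the connected P.  If instead z < a,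
-- criticality gives z < b, so a ∈ M(P(a,b)): then (a,b) is not a cover pair,
-- and the path a – z – b survives the removal of any cover pair (x,y), so a
-- connected P(a,b) \ (x,y) would make P \ (x,y) connected.  The case b < w
-- is dual, via the path a – w – b.
module Submission where

open import Defs
open import Data.Nat using (ℕ; suc)
open import Data.Fin using (Fin; _≟_)
open import Data.Bool using (T)
open import Data.Bool.Properties using (T-∧; T-∨)
open import Data.Product using (_×_; _,_; proj₁; proj₂)
open import Data.Sum using (_⊎_; inj₁; inj₂)
open import Function.Base using (_∘_)
open import Function.Bundles using (Equivalence)
open import Relation.Binary.Core using (_⇒_)
open import Relation.Nullary using (¬_; yes; no; contradiction)
open import Relation.Binary.PropositionalEquality using (_≡_; _≢_; refl; sym)

open Equivalence using (to; from)

module _ {n : ℕ} (R : Rel n) where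

  add-intro : ∀ {a b u v} → T (R u v) → T (add R a b u v)
  add-intro {u = u} {v} r = from (T-∨ {R u v}) (inj₁ r)

  add-new : ∀ {a b} → T (add R a b a b)
  add-new {a} {b} with a ≟ a | b ≟ b
  ... | yes _ | yes _ = from (T-∨ {R a b}) (inj₂ _)
  ... | no a≢a | _ = contradiction refl a≢a
  ... | yes _ | no b≢b = contradiction refl b≢b

  add-elim : ∀ {a b u v} → T (add R a b u v) → T (R u v) ⊎ (u ≡ a × v ≡ b)
  add-elim {a} {b} {u} {v} r with to (T-∨ {R u v}) r
  ... | inj₁ r′ = inj₁ r′
  ... | inj₂ _ with u ≟ a | v ≟ b
  -- The omitted cases leave an argument of type T false in context.
  ...   | yes u≡a | yes v≡b = inj₂ (u≡a , v≡b)

  remove-intro : ∀ {x y u v} → T (R u v) → ¬ (u ≡ x × v ≡ y) → T (remove R x y u v)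
  remove-intro {x} {y} {u} {v} r u,v≢x,y with u ≟ x | v ≟ y
  ... | yes u≡x | yes v≡y = contradiction (u≡x , v≡y) u,v≢x,y
  ... | yes _ | no _ = from (T-∧ {R u v}) (r , _)
  ... | no _ | _ = from (T-∧ {R u v}) (r , _)

  remove-elim : ∀ {x y u v} → T (remove R x y u v) → T (R u v) × ¬ (u ≡ x × v ≡ y)
  remove-elim {x} {y} {u} {v} r with to (T-∧ {R u v}) r
  ... | r′ , kept with u ≟ x | v ≟ y
  ...   | yes _ | no v≢y = r′ , v≢y ∘ proj₂
  ...   | no u≢x | _ = r′ , u≢x ∘ proj₁

module _ {n : ℕ} where

  Comparable-≤ : ∀ {S : Rel n} {u v} → T (S u v) → Comparable S u v
  Comparable-≤ {S} {u} {v} r = from (T-∨ {S u v}) (inj₁ r)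

  Comparable-≥ : ∀ {S : Rel n} {u v} → T (S v u) → Comparable S u v
  Comparable-≥ {S} {u} {v} r = from (T-∨ {S u v}) (inj₂ r)

  Comparable-sym : ∀ {S : Rel n} {u v} → Comparable S u v → Comparable S v u
  Comparable-sym {S} {u} {v} c with to (T-∨ {S u v}) c
  ... | inj₁ r = Comparable-≥ {S} r
  ... | inj₂ r = Comparable-≤ {S} r

  Reach-trans : ∀ {S : Rel n} {u v w} → Reach S u v → Reach S v w → Reach S u w
  Reach-trans here q = q
  Reach-trans (step c p) q = step c (Reach-trans p q)

  Reach-sym : ∀ {S : Rel n} {u v} → Reach S u v → Reach S v u
  Reach-sym here = here
  Reach-sym {S} (step c p) = Reach-trans (Reach-sym p) (step (Comparable-sym {S} c) here)

  Reach-refine : ∀ {S S′ : Rel n} → (∀ {u v} → T (S u v) → Reach S′ u v) → Reach S ⇒ Reach S′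
  Reach-refine edge here = here
  Reach-refine {S} edge (step {u} {v} c p) with to (T-∨ {S u v}) c
  ... | inj₁ r = Reach-trans (edge r) (Reach-refine edge p)
  ... | inj₂ r = Reach-trans (Reach-sym (edge r)) (Reach-refine edge p)

  Connected-refine : ∀ {S S′ : Rel n} → (∀ {u v} → T (S u v) → Reach S′ u v) →
                     Connected S → Connected S′
  Connected-refine edge c u v = Reach-refine edge (c u v)

  Connected-mono : ∀ {S S′ : Rel n} → _≤R_ S ⇒ _≤R_ S′ → Connected S → Connected S′
  Connected-mono {S′ = S′} S⊆S′ =
    Connected-refine λ r → step (Comparable-≤ {S′} (S⊆S′ r)) here

  InM-mono : ∀ {S S′ : Rel n} → _≤R_ S ⇒ _≤R_ S′ → ∀ {t} → InM S t → InM S′ t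
  InM-mono S⊆S′ (¬min , ¬max) =
    (λ min → ¬min λ z z≤t → min z (S⊆S′ z≤t)) , (λ max → ¬max λ z t≤z → max z (S⊆S′ t≤z))

  Prec-reflect : ∀ {S S′ : Rel n} → _≤R_ S ⇒ _≤R_ S′ → ∀ {x y} → T (S x y) →
                 Prec S′ x y → Prec S x y
  Prec-reflect S⊆S′ x≤y ((_ , x≢y) , no-middle) =
    (x≤y , x≢y) , λ z x≤z z≤y z-mid → no-middle z (S⊆S′ x≤z) (S⊆S′ z≤y) (InM-mono S⊆S′ z-mid)

  Prec-avoids-middle : ∀ {S : Rel n} {x y c u v} → Prec S x y → InM S c →
                       T (S u c) → T (S c v) → ¬ (u ≡ x × v ≡ y)
  Prec-avoids-middle (_ , no-middle) c-mid u≤c c≤v (refl , refl) = no-middle _ u≤c c≤v c-mid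

  ≰⇒≢ : ∀ {S : Rel n} → (∀ x → T (S x x)) → ∀ {a b} → ¬ T (S a b) → a ≢ b
  ≰⇒≢ refl-S {a} a≰b refl = a≰b (refl-S a)

module _ {n : ℕ} {R : Rel n} {a b : Fin n} where

  private
    R′ : Rel n
    R′ = add R a b

  add-Minimal : Minimal R a → Minimal R′ a
  add-Minimal min z z≤a with add-elim R z≤a
  ... | inj₁ z≤a = min z z≤a
  ... | inj₂ (z≡a , _) = z≡a

  add-Maximal : Maximal R b → Maximal R′ b
  add-Maximal max z b≤z with add-elim R b≤z
  ... | inj₁ b≤z = max z b≤z
  ... | inj₂ (_ , z≡b) = z≡b

  add-Prec : IsPoset R → ¬ T (R a b) → Minimal R a → Maximal R b → Prec R′ a b
  add-Prec po a≰b min max = (add-new R , ≰⇒≢ (IsPoset.refl po) a≰b) , no-middle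
    where
    no-middle : ∀ t → T (R′ a t) → T (R′ t b) → ¬ InM R′ t
    no-middle t a≤t t≤b (¬min , ¬max) with add-elim R a≤t | add-elim R t≤b
    ... | inj₂ (_ , refl) | _ = ¬max (add-Maximal max)
    ... | inj₁ _ | inj₂ (refl , _) = ¬min (add-Minimal min)
    ... | inj₁ a≤t | inj₁ t≤b = a≰b (IsPoset.trans po a t b a≤t t≤b)

  remove-add-⊇ : ¬ T (R a b) → _≤R_ R ⇒ _≤R_ (remove R′ a b)
  remove-add-⊇ a≰b r = remove-intro R′ (add-intro R r) λ { (refl , refl) → a≰b r }

  ¬HasFPP-add-minimal-maximal : IsPoset R → Connected R → ¬ T (R a b) →
                                Minimal R a → Maximal R b → ¬ HasFPP R′
  ¬HasFPP-add-minimal-maximal po c a≰b min max (_ , fpp) =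
    fpp a b (add-Prec po a≰b min max) (Connected-mono (remove-add-⊇ a≰b) c)

  HasFPP-add-bridged : HasFPP R → ¬ Prec R′ a b →
                       (∀ {x y} → Prec R′ x y → Reach (remove R x y) a b) → HasFPP R′
  HasFPP-add-bridged (c , fpp) ¬prec bridge = Connected-mono (add-intro R) c , fpp′
    where
    fpp′ : ∀ x y → Prec R′ x y → ¬ Connected (remove R′ x y)
    fpp′ x y prec c′ with add-elim R (proj₁ (proj₁ prec))
    ... | inj₂ (refl , refl) = ¬prec prec
    ... | inj₁ x≤y = fpp x y (Prec-reflect (add-intro R) x≤y prec) (Connected-refine edge c′)
      where
      edge : ∀ {u v} → T (remove R′ x y u v) → Reach (remove R x y) u v
      edge r with remove-elim R′ r
      ... | u≤′v , kept with add-elim R u≤′v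
      ...   | inj₁ u≤v = step (Comparable-≤ {S = remove R x y} (remove-intro R u≤v kept)) here
      ...   | inj₂ (refl , refl) = bridge prec

  HasFPP-add-below-source : IsPoset R → Crit R a b → HasFPP R → ∀ {z} → _<R_ R z a → HasFPP R′
  HasFPP-add-below-source po (a≰b , _ , below , _) fpp {z} (z≤a , z≢a) =
    HasFPP-add-bridged fpp (λ prec → avoid prec a≤′a (add-new R) (refl , refl)) bridge
    where
    a≤′a : T (R′ a a)
    a≤′a = add-intro R (IsPoset.refl po a)
    z≤′a : T (R′ z a)
    z≤′a = add-intro R z≤a
    a-middle : InM R′ a
    a-middle = (λ min → z≢a (min z z≤′a))
             , (λ max → ≰⇒≢ (IsPoset.refl po) a≰b (sym (max b (add-new R))))
    avoid : ∀ {x y u v} → Prec R′ x y → T (R′ u a) → T (R′ a v) → ¬ (u ≡ x × v ≡ y)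
    avoid prec = Prec-avoids-middle prec a-middle
    bridge : ∀ {x y} → Prec R′ x y → Reach (remove R x y) a b
    bridge {x} {y} prec =
      step (Comparable-≥ {S = remove R x y} (remove-intro R z≤a (avoid prec z≤′a a≤′a)))
        (step (Comparable-≤ {S = remove R x y} (remove-intro R z≤b (avoid prec z≤′a (add-new R))))
          here)
      where
      z≤b : T (R z b)
      z≤b = proj₁ (below z (z≤a , z≢a))

  HasFPP-add-above-target : IsPoset R → Crit R a b → HasFPP R → ∀ {w} → _<R_ R b w → HasFPP R′
  HasFPP-add-above-target po (a≰b , _ , _ , above) fpp {w} (b≤w , b≢w) =
    HasFPP-add-bridged fpp (λ prec → avoid prec (add-new R) b≤′b (refl , refl)) bridge
    where
    b≤′b : T (R′ b b)
    b≤′b = add-intro R (IsPoset.refl po b)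
    b≤′w : T (R′ b w)
    b≤′w = add-intro R b≤w
    b-middle : InM R′ b
    b-middle = (λ min → ≰⇒≢ (IsPoset.refl po) a≰b (min a (add-new R)))
             , (λ max → b≢w (sym (max w b≤′w)))
    avoid : ∀ {x y u v} → Prec R′ x y → T (R′ u b) → T (R′ b v) → ¬ (u ≡ x × v ≡ y)
    avoid prec = Prec-avoids-middle prec b-middle
    bridge : ∀ {x y} → Prec R′ x y → Reach (remove R x y) a b
    bridge {x} {y} prec =
      step (Comparable-≤ {S = remove R x y} (remove-intro R a≤w (avoid prec (add-new R) b≤′w)))
        (step (Comparable-≥ {S = remove R x y} (remove-intro R b≤w (avoid prec b≤′b b≤′w)))
          here)
      where
      a≤w : T (R a w)
      a≤w = proj₁ (above w (b≤w , b≢w))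

  Minimal-of-¬HasFPP-add : IsPoset R → Crit R a b → HasFPP R → ¬ HasFPP R′ → Minimal R a
  Minimal-of-¬HasFPP-add po crit fpp ¬fpp′ z z≤a with z ≟ a
  ... | yes z≡a = z≡a
  ... | no z≢a = contradiction (HasFPP-add-below-source po crit fpp (z≤a , z≢a)) ¬fpp′

  Maximal-of-¬HasFPP-add : IsPoset R → Crit R a b → HasFPP R → ¬ HasFPP R′ → Maximal R b
  Maximal-of-¬HasFPP-add po crit fpp ¬fpp′ w b≤w with w ≟ b
  ... | yes w≡b = w≡b
  ... | no w≢b = contradiction (HasFPP-add-above-target po crit fpp (b≤w , w≢b ∘ sym)) ¬fpp′

proposition2 : (n : ℕ) (R : Rel (suc n)) → IsPoset R → Connected R →
    (a b : Fin (suc n)) → Crit R a b →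
    ((Minimal R a × Maximal R b) → ¬ HasFPP (add R a b))
    × (HasFPP R → ¬ HasFPP (add R a b) → Minimal R a × Maximal R b)
proposition2 n R po c a b crit =
  (λ (min , max) → ¬HasFPP-add-minimal-maximal po c (proj₁ crit) min max) ,
  (λ fpp ¬fpp′ → Minimal-of-¬HasFPP-add po crit fpp ¬fpp′
               , Maximal-of-¬HasFPP-add po crit fpp ¬fpp′)
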